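{- For all $n\geq0$, \[ j_{2n}(231)=\frac{1}{2n+1}\binom{3n}{n}\quad\text{and}\quad j_{2n+1}(231)=\frac{1}{2n+1}\binom{3n+1}{n+1}. \]
   Context: A permutation of a finite set $S$ of positive integers is a word in which each element of $S$ appears exactly once; $\mathfrak{S}_n$ is the set of permutations of $\{1,\dots,n\}$. For a permutation $\pi$ and a letter $x$ of $\pi$, $\rho_\pi(x)$ is the maximal consecutive subword of $\pi$ consisting of the letters immediately to the right of $x$ that are all larger than $x$. $\pi$ is Jacobi if $|\rho_\pi(x)|$ is even for all letters $x$. A permutation $\pi$ avoids a pattern $\sigma$ if no subword of $\pi$ has standardization (relative order) $\sigma$. $j_n(231)$ is the number of $231$-avoiding Jacobi permutations in $\mathfrak{S}_n$. -}

module Defs where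

open import Data.Nat using (ℕ; zero; suc; _+_; _*_; _<_; _≤_; _<ᵇ_)
open import Data.Bool using (T?; Bool; true; false; _∧_; _∨_; not; if_then_else_)
open import Data.List using (List; []; _∷_; map; concatMap; length; filter; _++_)
open import Data.Bool.ListAction using (any)

oneTo : ℕ → List ℕ
oneTo zero = []
oneTo (suc n) = oneTo n ++ (suc n ∷ [])

insertions : ℕ → List ℕ → List (List ℕ)
insertions x [] = (x ∷ []) ∷ []
insertions x (y ∷ ys) = (x ∷ y ∷ ys) ∷ map (y ∷_) (insertions x ys)

perms : ℕ → List (List ℕ)
perms zero = [] ∷ []
perms (suc n) = concatMap (insertions (suc n)) (perms n)

-- |ρ_π(x)| for x the first letter of x ∷ rest: length of the maximal run
-- of letters immediately to the right of x that are all larger than x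
rhoLen : ℕ → List ℕ → ℕ
rhoLen x [] = zero
rhoLen x (y ∷ ys) = if x <ᵇ y then suc (rhoLen x ys) else zero

even? : ℕ → Bool
even? zero = true
even? (suc zero) = false
even? (suc (suc n)) = even? n

isJacobi : List ℕ → Bool
isJacobi [] = true
isJacobi (x ∷ xs) = even? (rhoLen x xs) ∧ isJacobi xs

contains231 : List ℕ → Bool
contains231 [] = false
contains231 (a ∷ rest) = pairs rest ∨ contains231 rest
  where
    pairs : List ℕ → Bool
    pairs [] = false
    pairs (b ∷ cs) = ((a <ᵇ b) ∧ any (λ c → c <ᵇ a) cs) ∨ pairs cs

avoids231 : List ℕ → Bool
avoids231 π = not (contains231 π)

j231 : ℕ → ℕ
j231 n = length (filter (λ π → T? (avoids231 π ∧ isJacobi π)) (perms n))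

{-# OPTIONS --safe #-}
-- A 231-avoiding π ∈ 𝔖_{N+1} is u (N+1) v with every letter of u below every letter of v and
-- u, v themselves 231-avoiding; π is moreover Jacobi iff u and v are and, when u is nonempty,
-- |v| is odd (ρ of the last letter of u is (N+1) v).  Hence
--   j_{N+1} = Σ_{k+m=N} [k = 0 ∨ m odd] j_k j_m.
-- Separating parities, E = Σ j_{2n} xⁿ and O = Σ j_{2n+1} xⁿ satisfy E = 1 + x E O and
-- O = E + x O², solved by E = T, O = T² for the ternary-tree series T = 1 + x T³.  The closed
-- forms of [xⁿ] T and [xⁿ] T² follow from [x^{n+1}] T^{k+1} = C(M, n+1) − 2 C(M, n),
-- M = 3(n+1) + k, which Pascal's rule proves by induction.
module Submission where

open import Data.Bool using (Bool; true; false; not; _∧_; _∨_; if_then_else_; T?)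
open import Data.Bool.ListAction using (any; all)
open import Data.Bool.Properties using (∧-assoc; ∧-identityʳ; ∧-zeroʳ; ∧-idem; ∧-conicalˡ; ∧-conicalʳ; ∨-assoc; ∨-zeroʳ; not-involutive)
open import Data.Empty using (⊥-elim)
open import Data.List using (List; []; _∷_; _++_; map; concatMap; length; take; drop; filter)
open import Data.List.Properties using (map-∘; take-all; drop-all; length-take; length-drop)
open import Data.List.Relation.Unary.All as All using (All; []; _∷_)
open import Data.List.Relation.Unary.All.Properties using (map⁺; concat⁺; take⁺; drop⁺)
open import Data.List.Relation.Unary.AllPairs using ([]; _∷_)
open import Data.List.Relation.Unary.Unique.Propositional using (Unique)
open import Data.Nat
open import Data.Nat.Combinatorics using (_C_; nC1≡n; k>n⇒nCk≡0; nCk+nC[k+1]≡[n+1]C[k+1])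
open import Data.Nat.Induction using (<-rec)
open import Data.Nat.Properties
open import Algebra.Properties.CommutativeSemigroup +-commutativeSemigroup using (interchange; x∙yz≈xz∙y; x∙yz≈y∙xz)
open import Algebra.Properties.CommutativeSemigroup *-commutativeSemigroup
  using () renaming (x∙yz≈y∙xz to *-x∙yz≈y∙xz; x∙yz≈z∙xy to *-x∙yz≈z∙xy)
open import Data.Nat.Tactic.RingSolver using (solve-∀)
open import Data.Product using (_×_; _,_; proj₁; proj₂)
open import Function using (_∘_)
open import Relation.Binary.PropositionalEquality
open ≡-Reasoning

open import Defs

-- Sums over lists and over antidiagonals

∑ : {A : Set} → List A → (A → ℕ) → ℕ
∑ []       f = 0
∑ (x ∷ xs) f = f x + ∑ xs f

infix 5 ∑
syntax ∑ xs (λ x → e) = ∑[ x ∈ xs ] e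

∑-cong-local : ∀ {A : Set} {f g : A → ℕ} {xs : List A} → All (λ x → f x ≡ g x) xs → ∑ xs f ≡ ∑ xs g
∑-cong-local []         = refl
∑-cong-local (eq ∷ eqs) = cong₂ _+_ eq (∑-cong-local eqs)

∑-cong : ∀ {A : Set} {f g : A → ℕ} (xs : List A) → (∀ x → f x ≡ g x) → ∑ xs f ≡ ∑ xs g
∑-cong []       eq = refl
∑-cong (x ∷ xs) eq = cong₂ _+_ (eq x) (∑-cong xs eq)

∑-*ˡ : ∀ {A : Set} c (f : A → ℕ) xs → ∑[ x ∈ xs ] (c * f x) ≡ c * ∑ xs f
∑-*ˡ c f []       = sym (*-zeroʳ c)
∑-*ˡ c f (x ∷ xs) = trans (cong (c * f x +_) (∑-*ˡ c f xs)) (sym (*-distribˡ-+ c (f x) _))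

∑-*ʳ : ∀ {A : Set} c (f : A → ℕ) xs → ∑[ x ∈ xs ] (f x * c) ≡ ∑ xs f * c
∑-*ʳ c f []       = refl
∑-*ʳ c f (x ∷ xs) = trans (cong (f x * c +_) (∑-*ʳ c f xs)) (sym (*-distribʳ-+ c (f x) _))

∑-++ : ∀ {A : Set} (f : A → ℕ) xs ys → ∑ (xs ++ ys) f ≡ ∑ xs f + ∑ ys f
∑-++ f []       ys = refl
∑-++ f (x ∷ xs) ys = trans (cong (f x +_) (∑-++ f xs ys)) (sym (+-assoc (f x) _ _))

∑-map : ∀ {A B : Set} (f : B → ℕ) (g : A → B) xs → ∑ (map g xs) f ≡ ∑[ x ∈ xs ] f (g x)
∑-map f g []       = refl
∑-map f g (x ∷ xs) = cong (f (g x) +_) (∑-map f g xs)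

∑-concatMap : ∀ {A B : Set} (f : B → ℕ) (g : A → List B) xs → ∑ (concatMap g xs) f ≡ ∑[ x ∈ xs ] ∑ (g x) f
∑-concatMap f g []       = refl
∑-concatMap f g (x ∷ xs) = trans (∑-++ f (g x) (concatMap g xs)) (cong (∑ (g x) f +_) (∑-concatMap f g xs))

∑⁺ : ℕ → (ℕ → ℕ → ℕ) → ℕ
∑⁺ zero    h = h 0 0
∑⁺ (suc n) h = h 0 (suc n) + ∑⁺ n (λ a b → h (suc a) b)

infix 5 ∑⁺
syntax ∑⁺ n (λ a b → e) = ∑[ a + b ≡ n ] e

∑⁺-cong-local : ∀ n {h h′ : ℕ → ℕ → ℕ} → (∀ a b → a + b ≡ n → h a b ≡ h′ a b) → ∑⁺ n h ≡ ∑⁺ n h′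
∑⁺-cong-local zero    eq = eq 0 0 refl
∑⁺-cong-local (suc n) eq = cong₂ _+_ (eq 0 (suc n) refl) (∑⁺-cong-local n (λ a b a+b≡n → eq (suc a) b (cong suc a+b≡n)))

∑⁺-cong : ∀ n {h h′ : ℕ → ℕ → ℕ} → (∀ a b → h a b ≡ h′ a b) → ∑⁺ n h ≡ ∑⁺ n h′
∑⁺-cong n eq = ∑⁺-cong-local n (λ a b _ → eq a b)

∑⁺-+ : ∀ n (h h′ : ℕ → ℕ → ℕ) → ∑[ a + b ≡ n ] (h a b + h′ a b) ≡ ∑⁺ n h + ∑⁺ n h′
∑⁺-+ zero    h h′ = refl
∑⁺-+ (suc n) h h′ = trans (cong (h 0 (suc n) + h′ 0 (suc n) +_) (∑⁺-+ n _ _)) (interchange (h 0 (suc n)) (h′ 0 (suc n)) _ _)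

∑⁺-zero : ∀ n → ∑[ a + b ≡ n ] 0 ≡ 0
∑⁺-zero zero    = refl
∑⁺-zero (suc n) = ∑⁺-zero n

∑-∑⁺-comm : ∀ {A : Set} (xs : List A) n (h : A → ℕ → ℕ → ℕ) →
            ∑[ x ∈ xs ] ∑⁺ n (h x) ≡ ∑[ a + b ≡ n ] ∑[ x ∈ xs ] h x a b
∑-∑⁺-comm []       n h = sym (∑⁺-zero n)
∑-∑⁺-comm (x ∷ xs) n h = trans (cong (∑⁺ n (h x) +_) (∑-∑⁺-comm xs n h)) (sym (∑⁺-+ n (h x) _))

_⊛_ : (ℕ → ℕ) → (ℕ → ℕ) → ℕ → ℕ
(f ⊛ g) n = ∑[ a + b ≡ n ] f a * g b

⊛-cong-≤ : ∀ n {f f′ g g′ : ℕ → ℕ} → (∀ a → a ≤ n → f a ≡ f′ a) → (∀ b → b ≤ n → g b ≡ g′ b) →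
           (f ⊛ g) n ≡ (f′ ⊛ g′) n
⊛-cong-≤ n eqf eqg = ∑⁺-cong-local n (λ a b a+b≡n →
  cong₂ _*_ (eqf a (subst (a ≤_) a+b≡n (m≤m+n a b))) (eqg b (subst (b ≤_) a+b≡n (m≤n+m b a))))

⊛-distribˡ-+ : ∀ n (f g h : ℕ → ℕ) → (f ⊛ (λ b → g b + h b)) n ≡ (f ⊛ g) n + (f ⊛ h) n
⊛-distribˡ-+ n f g h = trans (∑⁺-cong n (λ a b → *-distribˡ-+ (f a) (g b) (h b))) (∑⁺-+ n _ _)

timesX : (ℕ → ℕ) → ℕ → ℕ
timesX g zero    = 0
timesX g (suc b) = g b

⊛-timesX : ∀ n (f g : ℕ → ℕ) → (f ⊛ timesX g) (suc n) ≡ (f ⊛ g) n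
⊛-timesX zero    f g = trans (cong (f 0 * g 0 +_) (*-zeroʳ (f 1))) (+-identityʳ _)
⊛-timesX (suc n) f g = cong (f 0 * g (suc n) +_) (⊛-timesX n (λ a → f (suc a)) g)


[1+k]*nC[1+k]+k*nCk≡n*nCk : ∀ n k → suc k * (n C suc k) + k * (n C k) ≡ n * (n C k)
[1+k]*nC[1+k]+k*nCk≡n*nCk zero zero = refl
[1+k]*nC[1+k]+k*nCk≡n*nCk zero (suc k)
  rewrite k>n⇒nCk≡0 {0} {suc (suc k)} z<s | k>n⇒nCk≡0 {0} {suc k} z<s | *-zeroʳ k = refl
[1+k]*nC[1+k]+k*nCk≡n*nCk (suc n) zero = begin
  1 * (suc n C 1) + 0  ≡⟨ cong (λ c → 1 * c + 0) (nC1≡n (suc n)) ⟩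
  1 * suc n + 0        ≡⟨ +-identityʳ (1 * suc n) ⟩
  1 * suc n            ≡⟨ *-comm 1 (suc n) ⟩
  suc n * 1            ∎
[1+k]*nC[1+k]+k*nCk≡n*nCk (suc n) (suc k) = begin
  (2 + k) * (suc n C (2 + k)) + (1 + k) * (suc n C (1 + k))
    ≡⟨ cong₂ (λ p q → (2 + k) * p + (1 + k) * q) (sym (nCk+nC[k+1]≡[n+1]C[k+1] n (1 + k)))
                                                  (sym (nCk+nC[k+1]≡[n+1]C[k+1] n k)) ⟩
  (2 + k) * (y + z) + (1 + k) * (x + y)
    ≡⟨ regroup k x y z ⟩
  y + ((2 + k) * z + (1 + k) * y) + x + ((1 + k) * y + k * x)
    ≡⟨ cong₂ (λ p q → y + p + x + q) ([1+k]*nC[1+k]+k*nCk≡n*nCk n (suc k)) ([1+k]*nC[1+k]+k*nCk≡n*nCk n k) ⟩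
  y + n * y + x + n * x
    ≡⟨ collect n x y ⟩
  suc n * (x + y)
    ≡⟨ cong (suc n *_) (nCk+nC[k+1]≡[n+1]C[k+1] n k) ⟩
  suc n * (suc n C suc k) ∎
  where
  x y z : ℕ
  x = n C k
  y = n C suc k
  z = n C suc (suc k)
  regroup : ∀ k x y z → (2 + k) * (y + z) + (1 + k) * (x + y) ≡ y + ((2 + k) * z + (1 + k) * y) + x + ((1 + k) * y + k * x)
  regroup = solve-∀
  collect : ∀ n x y → y + n * y + x + n * x ≡ suc n * (x + y)
  collect = solve-∀

[2+3k]C[1+k]≡2*[2+3k]Ck : ∀ k → (2 + 3 * k) C suc k ≡ 2 * ((2 + 3 * k) C k)
[2+3k]C[1+k]≡2*[2+3k]Ck k = *-cancelˡ-≡ _ _ (suc k) (+-cancelʳ-≡ (k * x) _ _ (begin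
  suc k * (N C suc k) + k * x  ≡⟨ [1+k]*nC[1+k]+k*nCk≡n*nCk N k ⟩
  N * x                        ≡⟨ split k x ⟩
  suc k * (2 * x) + k * x      ∎))
  where
  N x : ℕ
  N = 2 + 3 * k
  x = N C k
  split : ∀ k x → (2 + 3 * k) * x ≡ suc k * (2 * x) + k * x
  split = solve-∀

-- raney n k = [xⁿ] Tᵏ for T = 1 + x T³, read off from T^{k+1} = Tᵏ + x T^{k+3}.
raney : ℕ → ℕ → ℕ
raney zero    k       = 1
raney (suc n) zero    = 0
raney (suc n) (suc k) = raney (suc n) k + raney n (3 + k)

raney-binomial : ∀ n k → raney (suc n) (suc k) + 2 * ((k + 3 * suc n) C n) ≡ (k + 3 * suc n) C suc n
raney-binomial zero zero = refl
raney-binomial zero (suc k) = begin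
  raney 1 (suc k) + 1 + 2  ≡⟨ +-assoc (raney 1 (suc k)) 1 2 ⟩
  raney 1 (suc k) + 3      ≡⟨ +-suc (raney 1 (suc k)) 2 ⟩
  suc (raney 1 (suc k) + 2) ≡⟨ cong suc (trans (raney-binomial zero k) (nC1≡n (k + 3))) ⟩
  suc (k + 3)              ≡⟨ nC1≡n (suc (k + 3)) ⟨
  suc (k + 3) C 1          ∎
raney-binomial (suc n) zero = begin
  r + 2 * ((3 * suc (suc n)) C suc n)
    ≡⟨ cong (λ c → r + 2 * (c C suc n)) N+1≡3[n+2] ⟨
  r + 2 * (suc N C suc n)
    ≡⟨ cong (λ c → r + 2 * c) (nCk+nC[k+1]≡[n+1]C[k+1] N n) ⟨
  r + 2 * (N C n + x)
    ≡⟨ regroup r (N C n) x ⟩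
  (r + 2 * (N C n)) + 2 * x
    ≡⟨ cong (_+ 2 * x) (raney-binomial n 2) ⟩
  x + 2 * x
    ≡⟨ cong (x +_) ([2+3k]C[1+k]≡2*[2+3k]Ck (suc n)) ⟨
  x + N C suc (suc n)
    ≡⟨ nCk+nC[k+1]≡[n+1]C[k+1] N (suc n) ⟩
  suc N C suc (suc n)
    ≡⟨ cong (λ c → c C suc (suc n)) N+1≡3[n+2] ⟩
  (3 * suc (suc n)) C suc (suc n) ∎
  where
  N r x : ℕ
  N = 2 + 3 * suc n
  r = raney (suc n) 3
  x = N C suc n
  N+1≡3[n+2] : suc N ≡ 3 * suc (suc n)
  N+1≡3[n+2] = sym (*-suc 3 (suc n))
  regroup : ∀ r y x → r + 2 * (y + x) ≡ (r + 2 * y) + 2 * x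
  regroup = solve-∀
raney-binomial (suc n) (suc k) = begin
  r₁ + r₂ + 2 * (suc N C suc n)
    ≡⟨ cong (λ c → r₁ + r₂ + 2 * c) (nCk+nC[k+1]≡[n+1]C[k+1] N n) ⟨
  r₁ + r₂ + 2 * (N C n + N C suc n)
    ≡⟨ regroup r₁ r₂ (N C n) (N C suc n) ⟩
  (r₁ + 2 * (N C suc n)) + (r₂ + 2 * (N C n))
    ≡⟨ cong₂ _+_ (raney-binomial (suc n) k) (subst (λ c → r₂ + 2 * (c C n) ≡ c C suc n) (same-N k n) (raney-binomial n (3 + k))) ⟩
  N C suc (suc n) + N C suc n
    ≡⟨ +-comm (N C suc (suc n)) (N C suc n) ⟩
  N C suc n + N C suc (suc n)
    ≡⟨ nCk+nC[k+1]≡[n+1]C[k+1] N (suc n) ⟩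
  suc N C suc (suc n) ∎
  where
  N r₁ r₂ : ℕ
  N = k + 3 * suc (suc n)
  r₁ = raney (suc (suc n)) (suc k)
  r₂ = raney (suc n) (4 + k)
  same-N : ∀ k n → (3 + k) + 3 * suc n ≡ k + 3 * suc (suc n)
  same-N = solve-∀
  regroup : ∀ r₁ r₂ a b → r₁ + r₂ + 2 * (a + b) ≡ (r₁ + 2 * b) + (r₂ + 2 * a)
  regroup = solve-∀

raney-one : ∀ n → (2 * n + 1) * raney n 1 ≡ (3 * n) C n
raney-one zero = refl
raney-one (suc m) = +-cancelʳ-≡ ((2 * m + 2) * x) _ _ (begin
  c * r + (2 * m + 2) * x  ≡⟨ cong (c * r +_) c*2y≡[2m+2]x ⟨
  c * r + c * (2 * y)      ≡⟨ *-distribˡ-+ c r (2 * y) ⟨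
  c * (r + 2 * y)          ≡⟨ cong (c *_) (raney-binomial m 0) ⟩
  c * x                    ≡⟨ peel m x ⟩
  x + (2 * m + 2) * x      ∎)
  where
  c r x y : ℕ
  c = 2 * suc m + 1
  r = raney (suc m) 1
  x = (3 * suc m) C suc m
  y = (3 * suc m) C m
  c*2y≡[2m+2]x : c * (2 * y) ≡ (2 * m + 2) * x
  c*2y≡[2m+2]x = +-cancelʳ-≡ (2 * (m * y)) _ _ (begin
    c * (2 * y) + 2 * (m * y)          ≡⟨ expand m y ⟩
    2 * (3 * suc m * y)                ≡⟨ cong (2 *_) ([1+k]*nC[1+k]+k*nCk≡n*nCk (3 * suc m) m) ⟨
    2 * (suc m * x + m * y)            ≡⟨ distribute m x y ⟩
    (2 * m + 2) * x + 2 * (m * y)      ∎)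
    where
    expand : ∀ m y → (2 * suc m + 1) * (2 * y) + 2 * (m * y) ≡ 2 * (3 * suc m * y)
    expand = solve-∀
    distribute : ∀ m x y → 2 * (suc m * x + m * y) ≡ (2 * m + 2) * x + 2 * (m * y)
    distribute = solve-∀
  peel : ∀ m x → (2 * suc m + 1) * x ≡ x + (2 * m + 2) * x
  peel = solve-∀

raney-two : ∀ n → (2 * n + 1) * raney n 2 ≡ (3 * n + 1) C (n + 1)
raney-two zero = refl
raney-two (suc m) = subst₂ (λ a b → c * r ≡ a C b) (+-comm 1 (3 * suc m)) (+-comm 1 (suc m))
  (*-cancelˡ-≡ _ _ (2 + m) (begin
    (2 + m) * (c * r)  ≡⟨ *-x∙yz≈y∙xz (2 + m) c r ⟩
    c * ((2 + m) * r)  ≡⟨ cong (c *_) [2+m]r≡x ⟩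
    c * x              ≡⟨ [2+m]z≡cx ⟨
    (2 + m) * z        ∎))
  where
  N c r x y z : ℕ
  N = 1 + 3 * suc m
  c = 2 * suc m + 1
  r = raney (suc m) 2
  x = N C suc m
  y = N C m
  z = N C suc (suc m)
  [2+m]2y≡[1+m]x : (2 + m) * (2 * y) ≡ suc m * x
  [2+m]2y≡[1+m]x = +-cancelʳ-≡ (m * y) _ _ (trans (expand m y) (sym ([1+k]*nC[1+k]+k*nCk≡n*nCk N m)))
    where
    expand : ∀ m y → (2 + m) * (2 * y) + m * y ≡ (1 + 3 * suc m) * y
    expand = solve-∀
  [2+m]r≡x : (2 + m) * r ≡ x
  [2+m]r≡x = +-cancelʳ-≡ (suc m * x) _ _ (begin
    (2 + m) * r + suc m * x        ≡⟨ cong ((2 + m) * r +_) [2+m]2y≡[1+m]x ⟨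
    (2 + m) * r + (2 + m) * (2 * y) ≡⟨ *-distribˡ-+ (2 + m) r (2 * y) ⟨
    (2 + m) * (r + 2 * y)          ≡⟨ cong ((2 + m) *_) (raney-binomial m 1) ⟩
    (2 + m) * x                    ≡⟨⟩
    x + suc m * x                  ∎)
  [2+m]z≡cx : (2 + m) * z ≡ c * x
  [2+m]z≡cx = +-cancelʳ-≡ (suc m * x) _ _ (trans ([1+k]*nC[1+k]+k*nCk≡n*nCk N (suc m)) (split m x))
    where
    split : ∀ m x → (1 + 3 * suc m) * x ≡ (2 * suc m + 1) * x + suc m * x
    split = solve-∀

⊛-raney₀ : ∀ n (f : ℕ → ℕ) → (f ⊛ (λ b → raney b 0)) n ≡ f n
⊛-raney₀ zero    f = *-identityʳ (f 0)
⊛-raney₀ (suc n) f = trans (cong (_+ ((λ a → f (suc a)) ⊛ (λ b → raney b 0)) n) (*-zeroʳ (f 0))) (⊛-raney₀ n (λ a → f (suc a)))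

raney-suc : ∀ l b → raney b (suc l) ≡ raney b l + timesX (λ b → raney b (3 + l)) b
raney-suc l zero    = refl
raney-suc l (suc b) = refl

raney-⊛ : ∀ n k l → ((λ a → raney a k) ⊛ (λ b → raney b l)) n ≡ raney n (k + l)
raney-⊛ n       k zero    = trans (⊛-raney₀ n (λ a → raney a k)) (cong (raney n) (sym (+-identityʳ k)))
raney-⊛ zero    k (suc l) = refl
raney-⊛ (suc n) k (suc l) = begin
  (Rₖ ⊛ (λ b → raney b (suc l))) (suc n)
    ≡⟨ ∑⁺-cong (suc n) (λ a b → cong (raney a k *_) (raney-suc l b)) ⟩
  (Rₖ ⊛ (λ b → raney b l + timesX (λ b → raney b (3 + l)) b)) (suc n)
    ≡⟨ ⊛-distribˡ-+ (suc n) Rₖ (λ b → raney b l) (timesX (λ b → raney b (3 + l))) ⟩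
  (Rₖ ⊛ (λ b → raney b l)) (suc n) + (Rₖ ⊛ timesX (λ b → raney b (3 + l))) (suc n)
    ≡⟨ cong₂ _+_ (raney-⊛ (suc n) k l) (trans (⊛-timesX n Rₖ _) (raney-⊛ n k (3 + l))) ⟩
  raney (suc n) (k + l) + raney n (k + (3 + l))
    ≡⟨ cong (λ j → raney (suc n) (k + l) + raney n j) (x∙yz≈y∙xz k 3 l) ⟩
  raney (suc n) (suc (k + l))
    ≡⟨ cong (raney (suc n)) (+-suc k l) ⟨
  raney (suc n) (k + suc l) ∎
  where
  Rₖ : ℕ → ℕ
  Rₖ a = raney a k

χ : Bool → ℕ
χ true  = 1
χ false = 0

odd? : ℕ → Bool
odd? n = not (even? n)

-- For u (N+1) v with |u| = k and |v| = m: when u is nonempty, ρ of its last letter is (N+1) v.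
jacobiSplit : ℕ → ℕ → Bool
jacobiSplit zero    m = true
jacobiSplit (suc k) m = odd? m

double : ℕ → ℕ
double zero    = zero
double (suc n) = suc (suc (double n))

double≡2* : ∀ n → double n ≡ 2 * n
double≡2* zero    = refl
double≡2* (suc n) = trans (cong (λ d → suc (suc d)) (double≡2* n)) (sym (*-suc 2 n))

even?-double : ∀ n → even? (double n) ≡ true
even?-double zero    = refl
even?-double (suc n) = even?-double n

even?-suc-double : ∀ n → even? (suc (double n)) ≡ false
even?-suc-double zero    = refl
even?-suc-double (suc n) = even?-suc-double n

∑⁺-double-suc : ∀ n h → ∑⁺ (double (suc n)) h ≡
  (∑[ a + b ≡ suc n ] h (double a) (double b)) + (∑[ a + b ≡ n ] h (suc (double a)) (suc (double b)))
∑⁺-suc-double : ∀ n h → ∑⁺ (suc (double n)) h ≡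
  (∑[ a + b ≡ n ] h (double a) (suc (double b))) + (∑[ a + b ≡ n ] h (suc (double a)) (double b))

∑⁺-double-suc n h = trans (cong (h 0 (double (suc n)) +_) (∑⁺-suc-double n (λ a b → h (suc a) b))) (x∙yz≈xz∙y (h 0 (double (suc n))) _ _)
∑⁺-suc-double zero    h = refl
∑⁺-suc-double (suc n) h = trans (cong (h 0 (suc (double (suc n))) +_) (∑⁺-double-suc n (λ a b → h (suc a) b))) (x∙yz≈xz∙y (h 0 (suc (double (suc n)))) _ _)

module JacobiRecurrence
  (J : ℕ → ℕ) (J-zero : J 0 ≡ 1)
  (J-suc : ∀ N → J (suc N) ≡ ∑[ k + m ≡ N ] χ (jacobiSplit k m) * (J k * J m))
  where

  E O : ℕ → ℕ
  E n = J (double n)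
  O n = J (suc (double n))

  term : ℕ → ℕ → ℕ
  term k m = χ (jacobiSplit k m) * (J k * J m)

  O-zero : O 0 ≡ 1
  O-zero = trans (J-suc 0) (trans (+-identityʳ (J 0 * J 0)) (cong₂ _*_ J-zero J-zero))

  E-suc : ∀ n → E (suc n) ≡ (E ⊛ O) n
  E-suc n = begin
    J (suc (suc (double n)))
      ≡⟨ J-suc (suc (double n)) ⟩
    ∑⁺ (suc (double n)) term
      ≡⟨ ∑⁺-suc-double n term ⟩
    (∑[ a + b ≡ n ] term (double a) (suc (double b))) + (∑[ a + b ≡ n ] term (suc (double a)) (double b))
      ≡⟨ cong₂ _+_ (∑⁺-cong n even-odd) (trans (∑⁺-cong n odd-even) (∑⁺-zero n)) ⟩
    (E ⊛ O) n + 0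
      ≡⟨ +-identityʳ _ ⟩
    (E ⊛ O) n ∎
    where
    even-odd : ∀ a b → term (double a) (suc (double b)) ≡ E a * O b
    even-odd zero    b = +-identityʳ _
    even-odd (suc a) b rewrite even?-suc-double b = +-identityʳ _
    odd-even : ∀ a b → term (suc (double a)) (double b) ≡ 0
    odd-even a b rewrite even?-double b = refl

  O-suc : ∀ n → O (suc n) ≡ E (suc n) + (O ⊛ O) n
  O-suc n = begin
    J (suc (double (suc n)))
      ≡⟨ J-suc (double (suc n)) ⟩
    ∑⁺ (double (suc n)) term
      ≡⟨ ∑⁺-double-suc n term ⟩
    (∑[ a + b ≡ suc n ] term (double a) (double b)) + (∑[ a + b ≡ n ] term (suc (double a)) (suc (double b)))
      ≡⟨ cong₂ _+_ (cong₂ _+_ first-term (trans (∑⁺-cong n even-even) (∑⁺-zero n))) (∑⁺-cong n odd-odd) ⟩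
    E (suc n) + 0 + (O ⊛ O) n
      ≡⟨ cong (_+ (O ⊛ O) n) (+-identityʳ _) ⟩
    E (suc n) + (O ⊛ O) n ∎
    where
    first-term : term 0 (double (suc n)) ≡ E (suc n)
    first-term = trans (+-identityʳ _) (trans (cong (_* E (suc n)) J-zero) (+-identityʳ _))
    even-even : ∀ a b → term (double (suc a)) (double b) ≡ 0
    even-even a b rewrite even?-double b = refl
    odd-odd : ∀ a b → term (suc (double a)) (suc (double b)) ≡ O a * O b
    odd-odd a b rewrite even?-suc-double b = +-identityʳ _

  E-O-raney : ∀ n → E n ≡ raney n 1 × O n ≡ raney n 2
  E-O-raney = <-rec _ step
    where
    step : ∀ n → (∀ {m} → m < n → E m ≡ raney m 1 × O m ≡ raney m 2) → E n ≡ raney n 1 × O n ≡ raney n 2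
    step zero    _  = J-zero , O-zero
    step (suc n) ih = E-eq , O-eq
      where
      E≤ : ∀ a → a ≤ n → E a ≡ raney a 1
      E≤ a a≤n = proj₁ (ih (s≤s a≤n))
      O≤ : ∀ a → a ≤ n → O a ≡ raney a 2
      O≤ a a≤n = proj₂ (ih (s≤s a≤n))
      -- raney (suc n) 1 reduces to raney n 3 and raney (suc n) 2 to raney (suc n) 1 + raney n 4:
      -- T = 1 + x T T² and T² = T + x T² T².
      E-eq : E (suc n) ≡ raney (suc n) 1
      E-eq = trans (E-suc n) (trans (⊛-cong-≤ n E≤ O≤) (raney-⊛ n 1 2))
      O-eq : O (suc n) ≡ raney (suc n) 2
      O-eq = trans (O-suc n) (cong₂ _+_ E-eq (trans (⊛-cong-≤ n O≤ O≤) (raney-⊛ n 2 2)))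

-- Splitting a permutation at its maximum

separated : List ℕ → List ℕ → Bool
separated u v = all (λ a → all (a <ᵇ_) v) u

<⇒<ᵇ≡true : ∀ {m n} → m < n → (m <ᵇ n) ≡ true
<⇒<ᵇ≡true z<s               = refl
<⇒<ᵇ≡true (s<s m<n@(s≤s _)) = <⇒<ᵇ≡true m<n

≥⇒<ᵇ≡false : ∀ {m n} → n ≤ m → (m <ᵇ n) ≡ false
≥⇒<ᵇ≡false {m}     {zero}  _         = refl
≥⇒<ᵇ≡false {suc m} {suc n} (s≤s n≤m) = ≥⇒<ᵇ≡false n≤m

<ᵇ-flip : ∀ {a c} → a ≢ c → (c <ᵇ a) ≡ not (a <ᵇ c)
<ᵇ-flip {zero}  {zero}  a≢c = ⊥-elim (a≢c refl)
<ᵇ-flip {zero}  {suc c} _   = refl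
<ᵇ-flip {suc a} {zero}  _   = refl
<ᵇ-flip {suc a} {suc c} a≢c = <ᵇ-flip (λ a≡c → a≢c (cong suc a≡c))

starts231 : ℕ → List ℕ → Bool
starts231 a []       = false
starts231 a (b ∷ cs) = ((a <ᵇ b) ∧ any (_<ᵇ a) cs) ∨ starts231 a cs

-- In Defs, contains231 (a ∷ r) unfolds to a local function of r that cannot be named;
-- it is identified with starts231 a through its defining equations.
starts231-unique : ∀ a {g : List ℕ → Bool} → g [] ≡ false →
                   (∀ b cs → g (b ∷ cs) ≡ ((a <ᵇ b) ∧ any (_<ᵇ a) cs) ∨ g cs) →
                   ∀ r → g r ≡ starts231 a r
starts231-unique a g[] g∷ []       = g[]
starts231-unique a g[] g∷ (b ∷ cs) = trans (g∷ b cs) (cong (((a <ᵇ b) ∧ any (_<ᵇ a) cs) ∨_) (starts231-unique a g[] g∷ cs))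

contains231-∷ : ∀ a r → contains231 (a ∷ r) ≡ starts231 a r ∨ contains231 r
contains231-∷ a = unfold
  where
  -- The `_` is the local function with its captured list abstracted to rest; the `with b ∷ cs`
  -- below performs that abstraction, keeping rest distinct from the argument so `_` is solvable.
  local≡starts231 : ∀ (rest s : List ℕ) → _ ≡ starts231 a s
  local≡starts231 rest = starts231-unique a refl (λ _ _ → refl)
  unfold : ∀ r → contains231 (a ∷ r) ≡ starts231 a r ∨ contains231 r
  unfold []       = refl
  unfold (b ∷ cs) with b ∷ cs
  ... | rest = cong (λ z → ((a <ᵇ b) ∧ any (_<ᵇ a) cs ∨ z) ∨ contains231 (b ∷ cs)) (local≡starts231 rest cs)

starts231-max : ∀ {X} v → All (_< X) v → starts231 X v ≡ false
starts231-max []       []           = refl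
starts231-max (b ∷ cs) (b<X ∷ cs<X) rewrite ≥⇒<ᵇ≡false (<⇒≤ b<X) = starts231-max cs cs<X

any∨starts231≡any : ∀ a v → any (_<ᵇ a) v ∨ starts231 a v ≡ any (_<ᵇ a) v
any∨starts231≡any a []       = refl
any∨starts231≡any a (b ∷ cs) with b <ᵇ a | any (_<ᵇ a) cs | any∨starts231≡any a cs
... | true  | _     | _  = refl
... | false | true  | _  = refl
... | false | false | eq = trans (cong (_∨ starts231 a cs) (∧-zeroʳ (a <ᵇ b))) eq

any-++-∷ : ∀ a X u v → (X <ᵇ a) ≡ false → any (_<ᵇ a) (u ++ X ∷ v) ≡ any (_<ᵇ a) u ∨ any (_<ᵇ a) v
any-++-∷ a X []      v X≮a = cong (_∨ any (_<ᵇ a) v) X≮a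
any-++-∷ a X (b ∷ u) v X≮a = trans (cong ((b <ᵇ a) ∨_) (any-++-∷ a X u v X≮a)) (sym (∨-assoc (b <ᵇ a) _ _))

starts231-++-∷ : ∀ {a X} u v → a < X → starts231 a (u ++ X ∷ v) ≡ starts231 a u ∨ any (_<ᵇ a) v
starts231-++-∷ {a}     []      v a<X rewrite <⇒<ᵇ≡true a<X = any∨starts231≡any a v
starts231-++-∷ {a} {X} (b ∷ u) v a<X = begin
  ((a <ᵇ b) ∧ any (_<ᵇ a) (u ++ X ∷ v)) ∨ starts231 a (u ++ X ∷ v)
    ≡⟨ cong₂ (λ p q → ((a <ᵇ b) ∧ p) ∨ q) (any-++-∷ a X u v (≥⇒<ᵇ≡false (<⇒≤ a<X))) (starts231-++-∷ u v a<X) ⟩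
  ((a <ᵇ b) ∧ (any (_<ᵇ a) u ∨ any (_<ᵇ a) v)) ∨ (starts231 a u ∨ any (_<ᵇ a) v)
    ≡⟨ absorb (a <ᵇ b) (any (_<ᵇ a) u) (any (_<ᵇ a) v) (starts231 a u) ⟩
  (((a <ᵇ b) ∧ any (_<ᵇ a) u) ∨ starts231 a u) ∨ any (_<ᵇ a) v ∎
  where
  absorb : ∀ p q r s → (p ∧ (q ∨ r)) ∨ (s ∨ r) ≡ ((p ∧ q) ∨ s) ∨ r
  absorb true  true  r     s     = refl
  absorb true  false true  s     = sym (∨-zeroʳ (false ∨ s))
  absorb true  false false s     = refl
  absorb false q     r     s     = refl

any-<ᵇ≡not-all : ∀ a v → All (a ≢_) v → any (_<ᵇ a) v ≡ not (all (a <ᵇ_) v)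
any-<ᵇ≡not-all a []      []            = refl
any-<ᵇ≡not-all a (c ∷ v) (a≢c ∷ a∉v) = begin
  (c <ᵇ a) ∨ any (_<ᵇ a) v              ≡⟨ cong₂ _∨_ (<ᵇ-flip a≢c) (any-<ᵇ≡not-all a v a∉v) ⟩
  not (a <ᵇ c) ∨ not (all (a <ᵇ_) v)    ≡⟨ not-∧ (a <ᵇ c) _ ⟨
  not ((a <ᵇ c) ∧ all (a <ᵇ_) v)        ∎
  where
  not-∧ : ∀ x y → not (x ∧ y) ≡ not x ∨ not y
  not-∧ true  y = refl
  not-∧ false y = refl

contains231-++-∷ : ∀ {X} u v → All (_< X) u → All (_< X) v → All (λ a → All (a ≢_) v) u →
                   contains231 (u ++ X ∷ v) ≡ not (separated u v) ∨ (contains231 u ∨ contains231 v)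
contains231-++-∷ {X} [] v [] v<X [] = trans (contains231-∷ X v) (cong (_∨ contains231 v) (starts231-max v v<X))
contains231-++-∷ {X} (a ∷ u) v (a<X ∷ u<X) v<X (a∉v ∷ u#v) = begin
  contains231 (a ∷ u ++ X ∷ v)
    ≡⟨ contains231-∷ a (u ++ X ∷ v) ⟩
  starts231 a (u ++ X ∷ v) ∨ contains231 (u ++ X ∷ v)
    ≡⟨ cong₂ _∨_ (starts231-++-∷ u v a<X) (contains231-++-∷ u v u<X v<X u#v) ⟩
  (starts231 a u ∨ any (_<ᵇ a) v) ∨ (not (separated u v) ∨ (contains231 u ∨ contains231 v))
    ≡⟨ cong (λ z → (starts231 a u ∨ z) ∨ (not (separated u v) ∨ (contains231 u ∨ contains231 v))) (any-<ᵇ≡not-all a v a∉v) ⟩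
  (starts231 a u ∨ not (all (a <ᵇ_) v)) ∨ (not (separated u v) ∨ (contains231 u ∨ contains231 v))
    ≡⟨ regroup (starts231 a u) (all (a <ᵇ_) v) (separated u v) (contains231 u) (contains231 v) ⟩
  not (all (a <ᵇ_) v ∧ separated u v) ∨ ((starts231 a u ∨ contains231 u) ∨ contains231 v)
    ≡⟨ cong (λ z → not (separated (a ∷ u) v) ∨ (z ∨ contains231 v)) (contains231-∷ a u) ⟨
  not (separated (a ∷ u) v) ∨ (contains231 (a ∷ u) ∨ contains231 v) ∎
  where
  regroup : ∀ p x k c d → (p ∨ not x) ∨ (not k ∨ (c ∨ d)) ≡ not (x ∧ k) ∨ ((p ∨ c) ∨ d)
  regroup true  true  true  c d = refl
  regroup true  true  false c d = refl
  regroup true  false k     c d = refl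
  regroup false true  true  c d = refl
  regroup false true  false c d = refl
  regroup false false k     c d = refl

even?-suc : ∀ n → even? (suc n) ≡ odd? n
even?-suc zero    = refl
even?-suc (suc n) = sym (trans (cong not (even?-suc n)) (not-involutive (even? n)))

rhoLen-max : ∀ {X} v → All (_< X) v → rhoLen X v ≡ 0
rhoLen-max []      []          = refl
rhoLen-max (c ∷ v) (c<X ∷ _) rewrite ≥⇒<ᵇ≡false (<⇒≤ c<X) = refl

isJacobi-max-∷ : ∀ {X} v → All (_< X) v → isJacobi (X ∷ v) ≡ isJacobi v
isJacobi-max-∷ v v<X rewrite rhoLen-max v v<X = refl

rhoLen-all : ∀ a v → all (a <ᵇ_) v ≡ true → rhoLen a v ≡ length v
rhoLen-all a []      _      = refl
rhoLen-all a (c ∷ v) a<c∧v with a <ᵇ c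
... | true = cong suc (rhoLen-all a v a<c∧v)

rhoLen-∷-above : ∀ {a X} v → a < X → all (a <ᵇ_) v ≡ true → rhoLen a (X ∷ v) ≡ suc (length v)
rhoLen-∷-above {a} {X} v a<X a<v = rhoLen-all a (X ∷ v) (cong₂ _∧_ (<⇒<ᵇ≡true a<X) a<v)

-- Once the run of letters above a reaches X it continues through all of v, gaining 1 + |v|,
-- which is even when |v| is odd.
even?-rhoLen-++-∷ : ∀ {a X} w v → a < X → all (a <ᵇ_) v ≡ true →
                    even? (rhoLen a (w ++ X ∷ v)) ∧ odd? (length v) ≡ even? (rhoLen a w) ∧ odd? (length v)
even?-rhoLen-++-∷ [] v a<X a<v
  rewrite rhoLen-∷-above v a<X a<v | even?-suc (length v) = ∧-idem (odd? (length v))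
even?-rhoLen-++-∷ {a} {X} (c ∷ w) v a<X a<v with a <ᵇ c
... | false = refl
... | true
  rewrite even?-suc (rhoLen a (w ++ X ∷ v)) | even?-suc (rhoLen a w)
  = not-cong (even? (rhoLen a (w ++ X ∷ v))) (even? (rhoLen a w)) (odd? (length v)) (even?-rhoLen-++-∷ w v a<X a<v)
  where
  not-cong : ∀ x y o → x ∧ o ≡ y ∧ o → not x ∧ o ≡ not y ∧ o
  not-cong x y true  x≡y = cong (λ b → not b ∧ true) (trans (sym (∧-identityʳ x)) (trans x≡y (∧-identityʳ y)))
  not-cong x y false _   = trans (∧-zeroʳ (not x)) (sym (∧-zeroʳ (not y)))

∧-distribʳ-∧ : ∀ x y o → (x ∧ y) ∧ o ≡ (x ∧ o) ∧ (y ∧ o)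
∧-distribʳ-∧ false y o     = refl
∧-distribʳ-∧ true  y true  = refl
∧-distribʳ-∧ true  y false = ∧-zeroʳ y

isJacobi-++-∷-∧-odd : ∀ {X} u v → All (_< X) u → All (_< X) v → separated u v ≡ true →
                      isJacobi (u ++ X ∷ v) ∧ odd? (length v) ≡ (isJacobi u ∧ isJacobi v) ∧ odd? (length v)
isJacobi-++-∷-∧-odd []      v []          v<X _   = cong (_∧ odd? (length v)) (isJacobi-max-∷ v v<X)
isJacobi-++-∷-∧-odd {X} (a ∷ u) v (a<X ∷ u<X) v<X sep = begin
  (even? (rhoLen a (u ++ X ∷ v)) ∧ isJacobi (u ++ X ∷ v)) ∧ o
    ≡⟨ ∧-distribʳ-∧ (even? (rhoLen a (u ++ X ∷ v))) _ o ⟩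
  (even? (rhoLen a (u ++ X ∷ v)) ∧ o) ∧ (isJacobi (u ++ X ∷ v) ∧ o)
    ≡⟨ cong₂ _∧_ (even?-rhoLen-++-∷ u v a<X (∧-conicalˡ _ (separated u v) sep)) (isJacobi-++-∷-∧-odd u v u<X v<X (∧-conicalʳ (all (a <ᵇ_) v) _ sep)) ⟩
  (even? (rhoLen a u) ∧ o) ∧ ((isJacobi u ∧ isJacobi v) ∧ o)
    ≡⟨ ∧-distribʳ-∧ (even? (rhoLen a u)) _ o ⟨
  (even? (rhoLen a u) ∧ (isJacobi u ∧ isJacobi v)) ∧ o
    ≡⟨ cong (_∧ o) (∧-assoc (even? (rhoLen a u)) (isJacobi u) (isJacobi v)) ⟨
  ((even? (rhoLen a u) ∧ isJacobi u) ∧ isJacobi v) ∧ o ∎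
  where
  o : Bool
  o = odd? (length v)

isJacobi-++-∷⇒odd : ∀ {X} a u v → All (_< X) (a ∷ u) → separated (a ∷ u) v ≡ true →
                    isJacobi (a ∷ u ++ X ∷ v) ≡ isJacobi (a ∷ u ++ X ∷ v) ∧ odd? (length v)
isJacobi-++-∷⇒odd {X} a [] v (a<X ∷ []) sep
  rewrite rhoLen-∷-above v a<X (∧-conicalˡ _ true sep) | even?-suc (length v) = idem-absorb (odd? (length v)) (isJacobi (X ∷ v))
  where
  idem-absorb : ∀ x y → x ∧ y ≡ (x ∧ y) ∧ x
  idem-absorb true  y = sym (∧-identityʳ y)
  idem-absorb false y = refl
isJacobi-++-∷⇒odd {X} a (b ∷ u) v (a<X ∷ bu<X) sep =
  trans (cong (even? (rhoLen a (b ∷ u ++ X ∷ v)) ∧_) (isJacobi-++-∷⇒odd b u v bu<X (∧-conicalʳ (all (a <ᵇ_) v) _ sep)))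
        (sym (∧-assoc (even? (rhoLen a (b ∷ u ++ X ∷ v))) _ _))

isJacobi-++-∷ : ∀ {X} u v → All (_< X) u → All (_< X) v → separated u v ≡ true →
                isJacobi (u ++ X ∷ v) ≡ isJacobi u ∧ (isJacobi v ∧ jacobiSplit (length u) (length v))
isJacobi-++-∷ []      v []     v<X _   = trans (isJacobi-max-∷ v v<X) (sym (∧-identityʳ (isJacobi v)))
isJacobi-++-∷ (a ∷ u) v au<X v<X sep = begin
  isJacobi (a ∷ u ++ _ ∷ v)
    ≡⟨ isJacobi-++-∷⇒odd a u v au<X sep ⟩
  isJacobi (a ∷ u ++ _ ∷ v) ∧ odd? (length v)
    ≡⟨ isJacobi-++-∷-∧-odd (a ∷ u) v au<X v<X sep ⟩
  (isJacobi (a ∷ u) ∧ isJacobi v) ∧ odd? (length v)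
    ≡⟨ ∧-assoc (isJacobi (a ∷ u)) (isJacobi v) _ ⟩
  isJacobi (a ∷ u) ∧ (isJacobi v ∧ odd? (length v)) ∎

jacobi231 : List ℕ → Bool
jacobi231 π = avoids231 π ∧ isJacobi π

jacobi231-++-∷ : ∀ {X} u v → All (_< X) u → All (_< X) v → All (λ a → All (a ≢_) v) u →
                 jacobi231 (u ++ X ∷ v) ≡ separated u v ∧ (jacobi231 u ∧ (jacobi231 v ∧ jacobiSplit (length u) (length v)))
jacobi231-++-∷ u v u<X v<X u#v with separated u v in sep
... | false rewrite contains231-++-∷ u v u<X v<X u#v | sep = refl
... | true  rewrite contains231-++-∷ u v u<X v<X u#v | sep | isJacobi-++-∷ u v u<X v<X sep =
  shuffle (contains231 u) (contains231 v) (isJacobi u) (isJacobi v) (jacobiSplit (length u) (length v))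
  where
  shuffle : ∀ cu cv ju jv s → not (cu ∨ cv) ∧ (ju ∧ (jv ∧ s)) ≡ (not cu ∧ ju) ∧ ((not cv ∧ jv) ∧ s)
  shuffle true  cv    ju jv s = refl
  shuffle false true  ju jv s = sym (∧-zeroʳ ju)
  shuffle false false ju jv s = refl

module OrderEmbedding (f : ℕ → ℕ) (f-<ᵇ : ∀ a b → (f a <ᵇ f b) ≡ (a <ᵇ b)) where

  any-<ᵇ-map : ∀ a r → any (_<ᵇ f a) (map f r) ≡ any (_<ᵇ a) r
  any-<ᵇ-map a []      = refl
  any-<ᵇ-map a (c ∷ r) = cong₂ _∨_ (f-<ᵇ c a) (any-<ᵇ-map a r)

  starts231-map : ∀ a r → starts231 (f a) (map f r) ≡ starts231 a r
  starts231-map a []      = refl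
  starts231-map a (c ∷ r) = cong₂ _∨_ (cong₂ _∧_ (f-<ᵇ a c) (any-<ᵇ-map a r)) (starts231-map a r)

  contains231-map : ∀ v → contains231 (map f v) ≡ contains231 v
  contains231-map []      = refl
  contains231-map (a ∷ r) = begin
    contains231 (f a ∷ map f r)                   ≡⟨ contains231-∷ (f a) (map f r) ⟩
    starts231 (f a) (map f r) ∨ contains231 (map f r) ≡⟨ cong₂ _∨_ (starts231-map a r) (contains231-map r) ⟩
    starts231 a r ∨ contains231 r                 ≡⟨ contains231-∷ a r ⟨
    contains231 (a ∷ r)                           ∎

  rhoLen-map : ∀ a r → rhoLen (f a) (map f r) ≡ rhoLen a r
  rhoLen-map a []      = refl
  rhoLen-map a (c ∷ r) = cong₂ (λ b n → if b then suc n else zero) (f-<ᵇ a c) (rhoLen-map a r)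

  isJacobi-map : ∀ v → isJacobi (map f v) ≡ isJacobi v
  isJacobi-map []      = refl
  isJacobi-map (a ∷ r) = cong₂ (λ n b → even? n ∧ b) (rhoLen-map a r) (isJacobi-map r)

  jacobi231-map : ∀ v → jacobi231 (map f v) ≡ jacobi231 v
  jacobi231-map v = cong₂ (λ c j → not c ∧ j) (contains231-map v) (isJacobi-map v)

+-<ᵇ-+ : ∀ k a b → ((k + a) <ᵇ (k + b)) ≡ (a <ᵇ b)
+-<ᵇ-+ zero    a b = refl
+-<ᵇ-+ (suc k) a b = +-<ᵇ-+ k a b

-- 𝔖ₙ built by inserting the maximum

insertions-length : ∀ X σ → All (λ τ → length τ ≡ suc (length σ)) (insertions X σ)
insertions-length X []       = refl ∷ []
insertions-length X (y ∷ ys) = refl ∷ map⁺ (All.map (cong suc) (insertions-length X ys))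

insertions-All : ∀ {P : ℕ → Set} X σ → P X → All P σ → All (All P) (insertions X σ)
insertions-All X []       pX []         = (pX ∷ []) ∷ []
insertions-All X (y ∷ ys) pX (py ∷ pys) = (pX ∷ py ∷ pys) ∷ map⁺ (All.map (py ∷_) (insertions-All X ys pX pys))

insertions-Unique : ∀ X σ → All (X ≢_) σ → Unique σ → All Unique (insertions X σ)
insertions-Unique X []       []           []              = ([] ∷ []) ∷ []
insertions-Unique X (y ∷ ys) (X≢y ∷ X∉ys) (y∉ys ∷ ys-uniq) =
  ((X≢y ∷ X∉ys) ∷ y∉ys ∷ ys-uniq) ∷ map⁺ (All.zipWith (λ (y∉τ , τ-uniq) → y∉τ ∷ τ-uniq)
    (insertions-All X ys (X≢y ∘ sym) y∉ys , insertions-Unique X ys X∉ys ys-uniq))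

insertions-all : ∀ (p : ℕ → Bool) X σ → p X ≡ true → All (λ τ → all p τ ≡ all p σ) (insertions X σ)
insertions-all p X []       pX = cong (_∧ true) pX ∷ []
insertions-all p X (y ∷ ys) pX = cong (_∧ all p (y ∷ ys)) pX
                                ∷ map⁺ (All.map (cong (p y ∧_)) (insertions-all p X ys pX))

insertions-map : ∀ (f : ℕ → ℕ) x v → insertions (f x) (map f v) ≡ map (map f) (insertions x v)
insertions-map f x []      = refl
insertions-map f x (c ∷ v) = cong ((f x ∷ f c ∷ map f v) ∷_) (begin
  map (f c ∷_) (insertions (f x) (map f v))  ≡⟨ cong (map (f c ∷_)) (insertions-map f x v) ⟩
  map (f c ∷_) (map (map f) (insertions x v)) ≡⟨ map-∘ (insertions x v) ⟨
  map (λ w → f c ∷ map f w) (insertions x v)  ≡⟨ map-∘ (insertions x v) ⟩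
  map (map f) (map (c ∷_) (insertions x v))   ∎)

∑-insertions : ∀ X σ (f : List ℕ → ℕ) → ∑ (insertions X σ) f ≡ ∑[ k + m ≡ length σ ] f (take k σ ++ X ∷ drop k σ)
∑-insertions X []       f = +-identityʳ (f (X ∷ []))
∑-insertions X (y ∷ ys) f =
  cong (f (X ∷ y ∷ ys) +_) (trans (∑-map f (y ∷_) (insertions X ys)) (∑-insertions X ys (λ τ → f (y ∷ τ))))

record BoundedDistinct (n : ℕ) (σ : List ℕ) : Set where
  field
    length≡  : length σ ≡ n
    bounded  : All (_≤ n) σ
    distinct : Unique σ

perms-boundedDistinct : ∀ n → All (BoundedDistinct n) (perms n)
perms-boundedDistinct zero    = record { length≡ = refl ; bounded = [] ; distinct = [] } ∷ []
perms-boundedDistinct (suc n) = concat⁺ (map⁺ (All.map insert-max (perms-boundedDistinct n)))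
  where
  insert-max : ∀ {σ} → BoundedDistinct n σ → All (BoundedDistinct (suc n)) (insertions (suc n) σ)
  insert-max {σ} σ-bd = All.zipWith (λ (len , (bnd , uniq)) → record { length≡ = len ; bounded = bnd ; distinct = uniq })
    ( All.map (λ eq → trans eq (cong suc length≡)) (insertions-length (suc n) σ)
    , All.zip ( insertions-All (suc n) σ ≤-refl (All.map m≤n⇒m≤1+n bounded)
              , insertions-Unique (suc n) σ (All.map (λ y≤n → >⇒≢ (s≤s y≤n)) bounded) distinct))
    where open BoundedDistinct σ-bd

separatedAt : ℕ → List ℕ → Bool
separatedAt k σ = separated (take k σ) (drop k σ)

χ-∧ : ∀ a b → χ (a ∧ b) ≡ χ a * χ b
χ-∧ true  b = sym (+-identityʳ (χ b))
χ-∧ false b = refl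

χ-∧-* : ∀ a b q → χ (a ∧ b) * q ≡ χ b * (χ a * q)
χ-∧-* a b q = begin
  χ (a ∧ b) * q    ≡⟨ cong (_* q) (χ-∧ a b) ⟩
  χ a * χ b * q    ≡⟨ cong (_* q) (*-comm (χ a) (χ b)) ⟩
  χ b * χ a * q    ≡⟨ *-assoc (χ b) (χ a) q ⟩
  χ b * (χ a * q)  ∎

all-<ᵇ-drop-max : ∀ {X} k σ → k < length σ → All (_< X) σ → all (X <ᵇ_) (drop k σ) ≡ false
all-<ᵇ-drop-max {X} zero (y ∷ σ) _       (y<X ∷ _)  = cong (_∧ all (X <ᵇ_) σ) (≥⇒<ᵇ≡false (<⇒≤ y<X))
all-<ᵇ-drop-max (suc k) (y ∷ σ) (s≤s k<) (_ ∷ σ<X) = all-<ᵇ-drop-max k σ k< σ<X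

-- Inserting the maximum X into the left part of the cut leaves X above the nonempty right part,
-- while inserting it into the right part does not affect separatedAt k.
∑-insertions-separatedAt : ∀ X k σ (φ : List ℕ → List ℕ → ℕ) → k ≤ length σ → All (_< X) σ →
  ∑[ τ ∈ insertions X σ ] χ (separatedAt k τ) * φ (take k τ) (drop k τ)
  ≡ χ (separatedAt k σ) * (∑[ w ∈ insertions X (drop k σ) ] φ (take k σ) w)
∑-insertions-separatedAt X zero    σ        φ _         _            = ∑-*ˡ 1 (φ []) (insertions X σ)
∑-insertions-separatedAt X (suc k) (y ∷ ys) φ (s≤s k≤) (y<X ∷ ys<X) = begin
  χ (separatedAt (suc k) (X ∷ y ∷ ys)) * φ (X ∷ take k (y ∷ ys)) (drop k (y ∷ ys))
    + ∑ (map (y ∷_) (insertions X ys)) (λ τ → χ (separatedAt (suc k) τ) * φ (take (suc k) τ) (drop (suc k) τ))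
    ≡⟨ cong₂ _+_ (cong (λ b → χ (b ∧ separatedAt k (y ∷ ys)) * φ (X ∷ take k (y ∷ ys)) (drop k (y ∷ ys))) (all-<ᵇ-drop-max k (y ∷ ys) (s≤s k≤) (y<X ∷ ys<X)))
                 (∑-map _ (y ∷_) (insertions X ys)) ⟩
  ∑[ τ ∈ insertions X ys ] χ (all (y <ᵇ_) (drop k τ) ∧ separatedAt k τ) * φ (y ∷ take k τ) (drop k τ)
    ≡⟨ ∑-cong (insertions X ys) (λ τ → χ-∧-* (all (y <ᵇ_) (drop k τ)) (separatedAt k τ) _) ⟩
  ∑[ τ ∈ insertions X ys ] χ (separatedAt k τ) * φ′ (take k τ) (drop k τ)
    ≡⟨ ∑-insertions-separatedAt X k ys φ′ k≤ ys<X ⟩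
  χ (separatedAt k ys) * (∑[ w ∈ insertions X (drop k ys) ] χ (all (y <ᵇ_) w) * φ (y ∷ take k ys) w)
    ≡⟨ cong (χ (separatedAt k ys) *_) (trans
         (∑-cong-local (All.map (λ {w} → cong (λ b → χ b * φ (y ∷ take k ys) w)) (insertions-all (y <ᵇ_) X (drop k ys) (<⇒<ᵇ≡true y<X))))
         (∑-*ˡ (χ (all (y <ᵇ_) (drop k ys))) (φ (y ∷ take k ys)) (insertions X (drop k ys)))) ⟩
  χ (separatedAt k ys) * (χ (all (y <ᵇ_) (drop k ys)) * (∑[ w ∈ insertions X (drop k ys) ] φ (y ∷ take k ys) w))
    ≡⟨ χ-∧-* (all (y <ᵇ_) (drop k ys)) (separatedAt k ys) (∑[ w ∈ insertions X (drop k ys) ] φ (y ∷ take k ys) w) ⟨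
  χ (separatedAt (suc k) (y ∷ ys)) * (∑[ w ∈ insertions X (drop k ys) ] φ (y ∷ take k ys) w) ∎
  where
  φ′ : List ℕ → List ℕ → ℕ
  φ′ u w = χ (all (y <ᵇ_) w) * φ (y ∷ u) w

separated-[]ʳ : ∀ u → separated u [] ≡ true
separated-[]ʳ []      = refl
separated-[]ʳ (a ∷ u) = separated-[]ʳ u

-- Only insertions into the right part survive, and there they build 𝔖_{m+1} shifted by k.
∑-perms-separatedAt : ∀ k m (φ : List ℕ → List ℕ → ℕ) →
  ∑[ σ ∈ perms (k + m) ] χ (separatedAt k σ) * φ (take k σ) (drop k σ)
  ≡ ∑[ u ∈ perms k ] ∑[ v ∈ perms m ] φ u (map (k +_) v)
∑-perms-separatedAt k zero φ =
  trans (cong (λ n → ∑ (perms n) ψ) (+-identityʳ k))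
        (∑-cong-local (All.map whole (perms-boundedDistinct k)))
  where
  ψ : List ℕ → ℕ
  ψ σ = χ (separatedAt k σ) * φ (take k σ) (drop k σ)
  whole : ∀ {σ} → BoundedDistinct k σ → ψ σ ≡ φ σ [] + 0
  whole {σ} bd rewrite take-all k σ (≤-reflexive (BoundedDistinct.length≡ bd))
                     | drop-all k σ (≤-reflexive (BoundedDistinct.length≡ bd))
                     | separated-[]ʳ σ = refl
∑-perms-separatedAt k (suc m) φ = begin
  ∑ (perms (k + suc m)) ψ
    ≡⟨ cong (λ n → ∑ (perms n) ψ) (+-suc k m) ⟩
  ∑ (concatMap (insertions X) (perms (k + m))) ψ
    ≡⟨ ∑-concatMap ψ (insertions X) (perms (k + m)) ⟩
  ∑[ σ ∈ perms (k + m) ] ∑ (insertions X σ) ψ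
    ≡⟨ ∑-cong-local (All.map insert-max (perms-boundedDistinct (k + m))) ⟩
  ∑[ σ ∈ perms (k + m) ] χ (separatedAt k σ) * φ̃ (take k σ) (drop k σ)
    ≡⟨ ∑-perms-separatedAt k m φ̃ ⟩
  ∑[ u ∈ perms k ] ∑[ v ∈ perms m ] φ̃ u (map (k +_) v)
    ≡⟨ ∑-cong (perms k) (λ u → ∑-cong (perms m) (shift-insertions u)) ⟩
  ∑[ u ∈ perms k ] ∑[ v ∈ perms m ] ∑[ w ∈ insertions (suc m) v ] φ u (map (k +_) w)
    ≡⟨ ∑-cong (perms k) (λ u → ∑-concatMap (λ w → φ u (map (k +_) w)) (insertions (suc m)) (perms m)) ⟨
  ∑[ u ∈ perms k ] ∑[ v ∈ perms (suc m) ] φ u (map (k +_) v) ∎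
  where
  X : ℕ
  X = suc (k + m)
  ψ : List ℕ → ℕ
  ψ σ = χ (separatedAt k σ) * φ (take k σ) (drop k σ)
  φ̃ : List ℕ → List ℕ → ℕ
  φ̃ u w = ∑ (insertions X w) (φ u)
  insert-max : ∀ {σ} → BoundedDistinct (k + m) σ →
               ∑ (insertions X σ) ψ ≡ χ (separatedAt k σ) * φ̃ (take k σ) (drop k σ)
  insert-max {σ} bd = ∑-insertions-separatedAt X k σ φ
    (subst (k ≤_) (sym (BoundedDistinct.length≡ bd)) (m≤m+n k m)) (All.map s≤s (BoundedDistinct.bounded bd))
  shift-insertions : ∀ u v → φ̃ u (map (k +_) v) ≡ ∑[ w ∈ insertions (suc m) v ] φ u (map (k +_) w)
  shift-insertions u v = begin
    ∑ (insertions X (map (k +_) v)) (φ u)              ≡⟨ cong (λ Y → ∑ (insertions Y (map (k +_) v)) (φ u)) (+-suc k m) ⟨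
    ∑ (insertions (k + suc m) (map (k +_) v)) (φ u)    ≡⟨ cong (λ ws → ∑ ws (φ u)) (insertions-map (k +_) (suc m) v) ⟩
    ∑ (map (map (k +_)) (insertions (suc m) v)) (φ u)  ≡⟨ ∑-map (φ u) (map (k +_)) (insertions (suc m) v) ⟩
    ∑[ w ∈ insertions (suc m) v ] φ u (map (k +_) w)   ∎

take-drop-disjoint : ∀ k (σ : List ℕ) → Unique σ → All (λ a → All (a ≢_) (drop k σ)) (take k σ)
take-drop-disjoint zero    σ        _              = []
take-drop-disjoint (suc k) []       _              = []
take-drop-disjoint (suc k) (y ∷ ys) (y∉ys ∷ uniq) = drop⁺ k y∉ys ∷ take-drop-disjoint k ys uniq

length-take-+ : ∀ k m (σ : List ℕ) → length σ ≡ k + m → length (take k σ) ≡ k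
length-take-+ k m σ len = trans (length-take k σ) (trans (cong (k ⊓_) len) (m≤n⇒m⊓n≡m (m≤m+n k m)))

length-drop-+ : ∀ k m (σ : List ℕ) → length σ ≡ k + m → length (drop k σ) ≡ m
length-drop-+ k m σ len = trans (length-drop k σ) (trans (cong (_∸ k) len) (m+n∸m≡n k m))

length-filter : ∀ (p : List ℕ → Bool) xs → length (filter (λ π → T? (p π)) xs) ≡ ∑[ π ∈ xs ] χ (p π)
length-filter p []       = refl
length-filter p (x ∷ xs) with p x
... | true  = cong suc (length-filter p xs)
... | false = length-filter p xs

jacobi231Count : ℕ → ℕ
jacobi231Count n = ∑[ π ∈ perms n ] χ (jacobi231 π)

χ-∧-∧ : ∀ a b c → χ (a ∧ (b ∧ c)) ≡ χ c * (χ a * χ b)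
χ-∧-∧ a b c = trans (χ-∧ a (b ∧ c)) (trans (cong (χ a *_) (χ-∧ b c)) (*-x∙yz≈z∙xy (χ a) (χ b) (χ c)))

∑-insertions-max : ∀ N σ → BoundedDistinct N σ →
  ∑[ π ∈ insertions (suc N) σ ] χ (jacobi231 π)
  ≡ ∑[ k + m ≡ N ] χ (separatedAt k σ) * (χ (jacobiSplit k m) * (χ (jacobi231 (take k σ)) * χ (jacobi231 (drop k σ))))
∑-insertions-max N σ bd = begin
  ∑[ π ∈ insertions (suc N) σ ] χ (jacobi231 π)
    ≡⟨ ∑-insertions (suc N) σ (λ π → χ (jacobi231 π)) ⟩
  ∑[ k + m ≡ length σ ] χ (jacobi231 (take k σ ++ suc N ∷ drop k σ))
    ≡⟨ cong (λ n → ∑[ k + m ≡ n ] χ (jacobi231 (take k σ ++ suc N ∷ drop k σ))) length≡ ⟩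
  ∑[ k + m ≡ N ] χ (jacobi231 (take k σ ++ suc N ∷ drop k σ))
    ≡⟨ ∑⁺-cong-local N split ⟩
  ∑[ k + m ≡ N ] χ (separatedAt k σ) * (χ (jacobiSplit k m) * (χ (jacobi231 (take k σ)) * χ (jacobi231 (drop k σ)))) ∎
  where
  open BoundedDistinct bd
  σ<X : All (_< suc N) σ
  σ<X = All.map s≤s bounded
  split : ∀ k m → k + m ≡ N → χ (jacobi231 (take k σ ++ suc N ∷ drop k σ))
        ≡ χ (separatedAt k σ) * (χ (jacobiSplit k m) * (χ (jacobi231 (take k σ)) * χ (jacobi231 (drop k σ))))
  split k m k+m≡N = begin
    χ (jacobi231 (take k σ ++ suc N ∷ drop k σ))
      ≡⟨ cong χ (jacobi231-++-∷ (take k σ) (drop k σ) (take⁺ k σ<X) (drop⁺ k σ<X) (take-drop-disjoint k σ distinct)) ⟩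
    χ (separatedAt k σ ∧ (jacobi231 (take k σ) ∧ (jacobi231 (drop k σ) ∧ jacobiSplit (length (take k σ)) (length (drop k σ)))))
      ≡⟨ cong₂ (λ a b → χ (separatedAt k σ ∧ (jacobi231 (take k σ) ∧ (jacobi231 (drop k σ) ∧ jacobiSplit a b))))
               (length-take-+ k m σ len) (length-drop-+ k m σ len) ⟩
    χ (separatedAt k σ ∧ (jacobi231 (take k σ) ∧ (jacobi231 (drop k σ) ∧ jacobiSplit k m)))
      ≡⟨ χ-∧ (separatedAt k σ) (jacobi231 (take k σ) ∧ (jacobi231 (drop k σ) ∧ jacobiSplit k m)) ⟩
    χ (separatedAt k σ) * χ (jacobi231 (take k σ) ∧ (jacobi231 (drop k σ) ∧ jacobiSplit k m))
      ≡⟨ cong (χ (separatedAt k σ) *_) (χ-∧-∧ (jacobi231 (take k σ)) (jacobi231 (drop k σ)) (jacobiSplit k m)) ⟩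
    χ (separatedAt k σ) * (χ (jacobiSplit k m) * (χ (jacobi231 (take k σ)) * χ (jacobi231 (drop k σ)))) ∎
    where
    len : length σ ≡ k + m
    len = trans length≡ (sym k+m≡N)

jacobi231Count-suc : ∀ N → jacobi231Count (suc N) ≡ ∑[ k + m ≡ N ] χ (jacobiSplit k m) * (jacobi231Count k * jacobi231Count m)
jacobi231Count-suc N = begin
  ∑ (concatMap (insertions (suc N)) (perms N)) g
    ≡⟨ ∑-concatMap g (insertions (suc N)) (perms N) ⟩
  ∑[ σ ∈ perms N ] ∑ (insertions (suc N) σ) g
    ≡⟨ ∑-cong-local (All.map (∑-insertions-max N _) (perms-boundedDistinct N)) ⟩
  ∑[ σ ∈ perms N ] ∑[ k + m ≡ N ] χ (separatedAt k σ) * φ k m (take k σ) (drop k σ)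
    ≡⟨ ∑-∑⁺-comm (perms N) N (λ σ k m → χ (separatedAt k σ) * φ k m (take k σ) (drop k σ)) ⟩
  ∑[ k + m ≡ N ] ∑[ σ ∈ perms N ] χ (separatedAt k σ) * φ k m (take k σ) (drop k σ)
    ≡⟨ ∑⁺-cong-local N (λ k m k+m≡N →
         trans (cong (λ n → ∑[ σ ∈ perms n ] χ (separatedAt k σ) * φ k m (take k σ) (drop k σ)) (sym k+m≡N))
               (∑-perms-separatedAt k m (φ k m))) ⟩
  ∑[ k + m ≡ N ] ∑[ u ∈ perms k ] ∑[ v ∈ perms m ] φ k m u (map (k +_) v)
    ≡⟨ ∑⁺-cong N factor ⟩
  ∑[ k + m ≡ N ] χ (jacobiSplit k m) * (jacobi231Count k * jacobi231Count m) ∎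
  where
  g : List ℕ → ℕ
  g π = χ (jacobi231 π)
  φ : ℕ → ℕ → List ℕ → List ℕ → ℕ
  φ k m u v = χ (jacobiSplit k m) * (g u * g v)
  factor : ∀ k m → ∑[ u ∈ perms k ] ∑[ v ∈ perms m ] φ k m u (map (k +_) v)
                   ≡ χ (jacobiSplit k m) * (jacobi231Count k * jacobi231Count m)
  factor k m = begin
    ∑[ u ∈ perms k ] ∑[ v ∈ perms m ] c * (g u * g (map (k +_) v))
      ≡⟨ ∑-cong (perms k) (λ u → ∑-cong (perms m) (λ v →
           cong (λ b → c * (g u * χ b)) (OrderEmbedding.jacobi231-map (k +_) (+-<ᵇ-+ k) v))) ⟩
    ∑[ u ∈ perms k ] ∑[ v ∈ perms m ] c * (g u * g v)
      ≡⟨ ∑-cong (perms k) (λ u → trans (∑-*ˡ c (λ v → g u * g v) (perms m)) (cong (c *_) (∑-*ˡ (g u) g (perms m)))) ⟩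
    ∑[ u ∈ perms k ] c * (g u * jacobi231Count m)
      ≡⟨ ∑-*ˡ c (λ u → g u * jacobi231Count m) (perms k) ⟩
    c * (∑[ u ∈ perms k ] g u * jacobi231Count m)
      ≡⟨ cong (c *_) (∑-*ʳ (jacobi231Count m) g (perms k)) ⟩
    c * (jacobi231Count k * jacobi231Count m) ∎
    where
    c : ℕ
    c = χ (jacobiSplit k m)

j231≡jacobi231Count : ∀ n → j231 n ≡ jacobi231Count n
j231≡jacobi231Count n = length-filter jacobi231 (perms n)

j231-raney : ∀ n → j231 (2 * n) ≡ raney n 1 × j231 (2 * n + 1) ≡ raney n 2
j231-raney n = trans (cong j231 (sym (double≡2* n))) (trans (j231≡jacobi231Count (double n)) E≡)
             , trans (cong j231 [2n+1]≡suc-double) (trans (j231≡jacobi231Count (suc (double n))) O≡)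
  where
  open JacobiRecurrence jacobi231Count refl jacobi231Count-suc
  E≡ : E n ≡ raney n 1
  E≡ = proj₁ (E-O-raney n)
  O≡ : O n ≡ raney n 2
  O≡ = proj₂ (E-O-raney n)
  [2n+1]≡suc-double : 2 * n + 1 ≡ suc (double n)
  [2n+1]≡suc-double = trans (+-comm (2 * n) 1) (cong suc (sym (double≡2* n)))

theorem5p8 : (n : ℕ) →
    ((2 * n + 1) * j231 (2 * n) ≡ (3 * n) C n) ×
    ((2 * n + 1) * j231 (2 * n + 1) ≡ (3 * n + 1) C (n + 1))
theorem5p8 n =
  trans (cong ((2 * n + 1) *_) (proj₁ (j231-raney n))) (raney-one n) ,
  trans (cong ((2 * n + 1) *_) (proj₂ (j231-raney n))) (raney-two n)
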